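{- Let $w$ be a permutation. No element of $\mathcal{P}(w)$ covers at least $3$ elements if and only if $w$ avoids the patterns $2413$ and $3142$.
   Context: For $w \in \mathfrak{S}_n$ in one-line notation $w(1)\cdots w(n)$, an interval of $w$ is a set of consecutive integers $[h,h+j]$ with $\{w(t) : t \in [i,i+j]\} = [h,h+j]$ for some $i$; the interval poset $\mathcal{P}(w)$ is the set of nonempty intervals of $w$ ordered by inclusion. A permutation $w$ avoids a pattern $\pi \in \mathfrak{S}_k$ if there are no indices $i_1 < \cdots < i_k$ such that $w(i_1)\cdots w(i_k)$ is order-isomorphic to $\pi$. -}

module Defs where

open import Data.Nat using (ℕ; _≤_; _<_; _+_)
open import Data.Fin using (Fin; toℕ)
import Data.Fin as F
open import Data.Fin.Permutation using (Permutation′; _⟨$⟩ʳ_)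
open import Data.Vec using (Vec; lookup; _∷_; [])
open import Data.Product using (Σ; ∃; _×_; _,_)
open import Relation.Binary.PropositionalEquality using (_≡_; _≢_)
open import Relation.Nullary using (¬_)
open import Function.Bundles using (_⇔_)

-- Convention: a permutation w ∈ 𝔖ₙ is a bijection Fin n → Fin n; positions
-- and values are 0-based (shift by one relative to the paper, harmless).
-- w(t) in one-line notation is  toℕ (w ⟨$⟩ʳ t).

val : {n : ℕ} → Permutation′ n → Fin n → ℕ
val w t = toℕ (w ⟨$⟩ʳ t)

-- A nonempty set of consecutive integers [h, h+j] is represented by the pair (h , j).
Seg : Set
Seg = ℕ × ℕ

_∈Seg_ : ℕ → Seg → Set
x ∈Seg (h , j) = h ≤ x × x ≤ h + j

_⊆Seg_ : Seg → Seg → Set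
A ⊆Seg B = ∀ x → x ∈Seg A → x ∈Seg B

_⊂Seg_ : Seg → Seg → Set
A ⊂Seg B = A ⊆Seg B × ¬ (B ⊆Seg A)

IsInterval : {n : ℕ} → Permutation′ n → Seg → Set
IsInterval {n} w (h , j) =
  h + j < n ×
  Σ ℕ λ i → i + j < n ×
    ((t : Fin n) → toℕ t ∈Seg (i , j) → val w t ∈Seg (h , j)) ×
    ((v : Fin n) → toℕ v ∈Seg (h , j) →
       Σ (Fin n) λ t → toℕ t ∈Seg (i , j) × w ⟨$⟩ʳ t ≡ v)

Covers : {n : ℕ} → Permutation′ n → Seg → Seg → Set
Covers w A B =
  IsInterval w A × IsInterval w B × B ⊂Seg A ×
  ¬ (Σ Seg λ C → IsInterval w C × B ⊂Seg C × C ⊂Seg A)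

SomeCoversThree : {n : ℕ} → Permutation′ n → Set
SomeCoversThree w =
  Σ Seg λ A → Σ Seg λ B₁ → Σ Seg λ B₂ → Σ Seg λ B₃ →
    Covers w A B₁ × Covers w A B₂ × Covers w A B₃ ×
    B₁ ≢ B₂ × B₁ ≢ B₃ × B₂ ≢ B₃

-- Pattern containment; the pattern π ∈ 𝔖ₖ is given by its one-line word.
Contains : {n k : ℕ} → Permutation′ n → Vec ℕ k → Set
Contains {n} {k} w π =
  Σ (Fin k → Fin n) λ f →
    ((a b : Fin k) → a F.< b → f a F.< f b) ×
    ((a b : Fin k) → (val w (f a) < val w (f b)) ⇔ (lookup π a < lookup π b))

Avoids : {n k : ℕ} → Permutation′ n → Vec ℕ k → Set
Avoids w π = ¬ Contains w π

p2413 : Vec ℕ 4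
p2413 = 2 ∷ 4 ∷ 1 ∷ 3 ∷ []

p3142 : Vec ℕ 4
p3142 = 3 ∷ 1 ∷ 4 ∷ 2 ∷ []

-- If w contains 2413 or 3142 at positions p₀ < p₁ < p₂ < p₃, then every interval containing two
-- of the values at p₀, p₁, p₂ contains all four values.  In a minimal interval A containing the four
-- values, the elements covered by A above the singletons of these three values are therefore pairwise
-- distinct, so A covers at least three elements.
-- Conversely, if w avoids both patterns, the values of w on the positions of an interval A with at
-- least two elements form a separable sequence, which is a direct or a skew sum.  So A is the union of
-- two adjacent intervals, and every element covered by A contains the least or the greatest value of
-- A; two covered elements sharing an endpoint of A are nested, hence equal.
module Submission where

open import Defs
open import Data.Vec using (Vec; lookup; _∷_; [])
open import Data.Nat as ℕ
  using (ℕ; zero; suc; pred; _+_; _∸_; _≤_; _<_; _>_; _⊓_; _⊔_; z≤n; s≤s; s≤s⁻¹; z<s; s<s; _≤?_)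
open import Data.Nat.Properties
open import Data.Nat.Induction using (<-wellFounded)
open import Data.Fin as F using (Fin; toℕ; fromℕ<; inject₁; #_)
import Data.Fin.Properties as Finₚ
open import Data.Fin.Properties using (toℕ-injective; toℕ<n; toℕ-fromℕ<; fromℕ<-toℕ; injective⇒≤)
open import Data.Fin.Permutation
  using (Permutation′; _⟨$⟩ʳ_; _⟨$⟩ˡ_; inverseˡ; inverseʳ) renaming (flip to _⁻¹)
open import Data.Product using (Σ; ∃; _×_; _,_; proj₁; proj₂)
open import Data.Product.Properties using (≡-dec)
open import Data.Sum using (_⊎_; inj₁; inj₂; [_,_]; [_,_]′; swap)
open import Data.Empty using (⊥; ⊥-elim)
open import Function.Base using (_∘_; id; flip)
open import Induction.WellFounded using (WellFounded; Acc; acc; module Subrelation)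
import Relation.Binary.Construct.On as On
open import Level using (0ℓ)
open import Relation.Binary.Core using (Rel)
open import Relation.Binary.Definitions using (Transitive; tri<; tri≈; tri>)
open import Function.Bundles using (_⇔_; mk⇔; Equivalence)
open import Data.Bool.Base using (T)
open import Relation.Binary.PropositionalEquality hiding ([_])
open import Relation.Nullary using (¬_; Dec; yes; no; _×-dec_; decidable-stable; ¬¬-excluded-middle)

-- All goals below are negations, so minimal elements are only needed in this ¬¬-form.
¬¬-minimal : ∀ {a r p} {A : Set a} {_≺_ : Rel A r} → WellFounded _≺_ →
  (P : A → Set p) → ∀ {x} → P x → ¬ ¬ (Σ A λ y → P y × (∀ {z} → z ≺ y → ¬ P z))
¬¬-minimal {_≺_ = _≺_} wf P px no-minimal = absent (wf _) px
  where
    absent : ∀ {x} → Acc _≺_ x → ¬ P x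
    absent (acc rs) px = no-minimal (_ , px , λ z≺x → absent (rs z≺x))

start : Seg → ℕ
start = proj₁

end : Seg → ℕ
end (h , j) = h + j

-- [x, y]; when y < x, truncated subtraction makes this the point x.
span : ℕ → ℕ → Seg
span x y = x , y ∸ x

private variable
  A B C : Seg
  x y z : ℕ

start∈ : start A ∈Seg A
start∈ {h , j} = ≤-refl , m≤m+n h j

end∈ : end A ∈Seg A
end∈ {h , j} = m≤m+n h j , ≤-refl

start≤end : start A ≤ end A
start≤end {h , j} = m≤m+n h j

∈-span⁺ : x ≤ z → z ≤ y → z ∈Seg span x y
∈-span⁺ {x} {z} {y} x≤z z≤y = x≤z , ≤-trans z≤y (m≤n+m∸n y x)

∈-span⁻ : x ≤ y → z ∈Seg span x y → x ≤ z × z ≤ y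
∈-span⁻ x≤y (x≤z , z≤) = x≤z , subst (_ ≤_) (m+[n∸m]≡n x≤y) z≤

end-span : x ≤ y → end (span x y) ≡ y
end-span = m+[n∸m]≡n

∈-point : x ∈Seg (y , 0) → x ≡ y
∈-point (y≤x , x≤y+0) = ≤-antisym (subst (_ ≤_) (+-identityʳ _) x≤y+0) y≤x

∈-bounded : x ∈Seg A → end A < y → x < y
∈-bounded (_ , x≤end) end<y = ≤-<-trans x≤end end<y

∈-convex : x ∈Seg A → z ∈Seg A → x ≤ y → y ≤ z → y ∈Seg A
∈-convex (a≤x , _) (_ , z≤b) x≤y y≤z = ≤-trans a≤x x≤y , ≤-trans y≤z z≤b

_∈?_ : (x : ℕ) (A : Seg) → Dec (x ∈Seg A)
x ∈? (h , j) = (h ≤? x) ×-dec (x ≤? h + j)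

⊆-intro : start B ≤ start A → end A ≤ end B → A ⊆Seg B
⊆-intro b≤a a'≤b' _ (a≤x , x≤a') = ≤-trans b≤a a≤x , ≤-trans x≤a' a'≤b'

⊆-start : A ⊆Seg B → start B ≤ start A
⊆-start A⊆B = proj₁ (A⊆B _ start∈)

⊆-end : A ⊆Seg B → end A ≤ end B
⊆-end A⊆B = proj₂ (A⊆B _ end∈)

⊆-antisym : A ⊆Seg B → B ⊆Seg A → A ≡ B
⊆-antisym {h , j} {h' , j'} A⊆B B⊆A with ≤-antisym (⊆-start B⊆A) (⊆-start A⊆B)
... | refl = cong (h ,_) (+-cancelˡ-≡ h j j' (≤-antisym (⊆-end A⊆B) (⊆-end B⊆A)))

⊂⇒length< : A ⊂Seg B → proj₂ A < proj₂ B
⊂⇒length< {h , j} {h' , j'} (A⊆B , B⊈A) with j ℕ.<? j'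
... | yes j<j' = j<j'
... | no j≮j' = ⊥-elim (B⊈A (⊆-intro h≤h' (+-mono-≤ (⊆-start A⊆B) (≮⇒≥ j≮j'))))
  where
    h≤h' : h ≤ h'
    h≤h' = +-cancelʳ-≤ j h h' (≤-trans (⊆-end A⊆B) (+-monoʳ-≤ h' (≮⇒≥ j≮j')))

⊂-wellFounded : WellFounded _⊂Seg_
⊂-wellFounded = Subrelation.wellFounded ⊂⇒length< (On.wellFounded proj₂ <-wellFounded)

⊃-within-wellFounded : ∀ A → WellFounded (λ C D → D ⊂Seg C × C ⊂Seg A)
⊃-within-wellFounded A = Subrelation.wellFounded room-shrinks (On.wellFounded room <-wellFounded)
  where
    room : Seg → ℕ
    room D = proj₂ A ∸ proj₂ D
    room-shrinks : ∀ {C D} → D ⊂Seg C × C ⊂Seg A → room C < room D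
    room-shrinks (D⊂C , C⊂A) = ∸-monoʳ-< (⊂⇒length< D⊂C) (<⇒≤ (⊂⇒length< C⊂A))

start-shared : start B ∈Seg A → A ⊆Seg B → start A ≡ start B
start-shared {B} {A@(_ , _)} s∈A A⊆B = ≤-antisym (proj₁ s∈A) (⊆-start A⊆B)

end-shared : end B ∈Seg A → A ⊆Seg B → end A ≡ end B
end-shared {B} {A@(_ , _)} e∈A A⊆B = ≤-antisym (⊆-end A⊆B) (proj₂ e∈A)

same-start⇒comparable : start A ≡ start B → A ⊆Seg B ⊎ B ⊆Seg A
same-start⇒comparable {h , j} {.h , j'} refl with ≤-total j j'
... | inj₁ j≤j' = inj₁ (⊆-intro ≤-refl (+-monoʳ-≤ h j≤j'))
... | inj₂ j'≤j = inj₂ (⊆-intro ≤-refl (+-monoʳ-≤ h j'≤j))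

same-end⇒comparable : end A ≡ end B → A ⊆Seg B ⊎ B ⊆Seg A
same-end⇒comparable {h , j} {h' , j'} eq with ≤-total h h'
... | inj₁ h≤h' = inj₂ (⊆-intro h≤h' (≤-reflexive (sym eq)))
... | inj₂ h'≤h = inj₁ (⊆-intro h'≤h (≤-reflexive eq))

Between : ℕ → ℕ → ℕ → Set
Between a c b = (a < c × c < b) ⊎ (b < c × c < a)

∈-between : ∀ {a b c} → a ∈Seg A → b ∈Seg A → Between a c b → c ∈Seg A
∈-between a∈A b∈A (inj₁ (a<c , c<b)) = ∈-convex a∈A b∈A (<⇒≤ a<c) (<⇒≤ c<b)
∈-between a∈A b∈A (inj₂ (b<c , c<a)) = ∈-convex b∈A a∈A (<⇒≤ b<c) (<⇒≤ c<a)

point⊂ : x ∈Seg A → y ∈Seg A → y ≢ x → (x , 0) ⊂Seg A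
point⊂ {x} x∈A y∈A y≢x =
  (λ z z∈ → subst (_∈Seg _) (sym (∈-point z∈)) x∈A) , λ A⊆x → y≢x (∈-point (A⊆x _ y∈A))

hull : Seg → Seg → Seg
hull A B = span (start A ⊓ start B) (end A ⊔ end B)

hull-ordered : start A ⊓ start B ≤ end A ⊔ end B
hull-ordered {A} = ≤-trans (m⊓n≤m _ _) (≤-trans (proj₂ (start∈ {A})) (m≤m⊔n _ _))

end-hull : end (hull A B) ≡ end A ⊔ end B
end-hull {A} {B} = end-span (hull-ordered {A} {B})

⊆-hullˡ : A ⊆Seg hull A B
⊆-hullˡ {A} {B} = ⊆-intro (m⊓n≤m _ _) (≤-trans (m≤m⊔n _ _) (≤-reflexive (sym (end-hull {A} {B}))))

⊆-hullʳ : B ⊆Seg hull A B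
⊆-hullʳ {B} {A} = ⊆-intro (m⊓n≤n _ _) (≤-trans (m≤n⊔m _ _) (≤-reflexive (sym (end-hull {A} {B}))))

hull-least : A ⊆Seg C → B ⊆Seg C → hull A B ⊆Seg C
hull-least {A} {C} {B} A⊆C B⊆C = ⊆-intro (⊓-glb (⊆-start A⊆C) (⊆-start B⊆C))
  (subst (_≤ end C) (sym (end-hull {A} {B})) (⊔-lub (⊆-end A⊆C) (⊆-end B⊆C)))

hull-split : x ∈Seg A → x ∈Seg B → y ∈Seg hull A B → y ∈Seg A ⊎ y ∈Seg B
hull-split {x} {A} {B} {y} x∈A x∈B y∈hull with ∈-span⁻ (hull-ordered {A} {B}) y∈hull | y ≤? x
... | lo≤y , y≤hi | yes y≤x with ⊓-sel (start A) (start B)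
...   | inj₁ eq = inj₁ (subst (_≤ y) eq lo≤y , ≤-trans y≤x (proj₂ x∈A))
...   | inj₂ eq = inj₂ (subst (_≤ y) eq lo≤y , ≤-trans y≤x (proj₂ x∈B))
hull-split {x} {A} {B} {y} x∈A x∈B y∈hull | lo≤y , y≤hi | no y≰x with ⊔-sel (end A) (end B)
...   | inj₁ eq = inj₁ (≤-trans (proj₁ x∈A) (<⇒≤ (≰⇒> y≰x)) , subst (y ≤_) eq y≤hi)
...   | inj₂ eq = inj₂ (≤-trans (proj₁ x∈B) (<⇒≤ (≰⇒> y≰x)) , subst (y ≤_) eq y≤hi)

∈-extend : x ∈Seg (y , suc z) → x ∈Seg (y , z) ⊎ x ≡ y + suc z
∈-extend {x} {y} {z} (y≤x , x≤) with x ≤? y + z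
... | yes x≤y+z = inj₁ (y≤x , x≤y+z)
... | no x≰y+z = inj₂ (≤-antisym x≤ (subst (_≤ x) (sym (+-suc y z)) (≰⇒> x≰y+z)))

∈-widen : x ∈Seg (y , z) → x ∈Seg (y , suc z)
∈-widen {y = y} {z} (y≤x , x≤) = y≤x , ≤-trans x≤ (+-monoʳ-≤ y (n≤1+n z))

argmax : (f : ℕ → ℕ) (A : Seg) → Σ ℕ λ x → x ∈Seg A × (∀ {y} → y ∈Seg A → f y ≤ f x)
argmax f (h , zero) = h , start∈ , λ y∈A → ≤-reflexive (cong f (∈-point y∈A))
argmax f (h , suc j) with argmax f (h , j)
... | x , x∈ , x-max with f (h + suc j) ≤? f x
...   | yes last≤ = x , ∈-widen x∈ , λ y∈ → [ x-max , (λ { refl → last≤ }) ] (∈-extend y∈)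
...   | no last≰ = h + suc j , end∈ , λ y∈ →
          [ (λ y∈' → ≤-trans (x-max y∈') (<⇒≤ (≰⇒> last≰))) , (λ { refl → ≤-refl }) ] (∈-extend y∈)

injective-on⇒length≤ : (f : ℕ → ℕ) → (∀ {x} → x ∈Seg A → f x ∈Seg B) →
  (∀ {x y} → x ∈Seg A → y ∈Seg A → f x ≡ f y → x ≡ y) → proj₂ A ≤ proj₂ B
injective-on⇒length≤ {s , j} {h , j'} f maps-to injective = s≤s⁻¹ (injective⇒≤ φ-injective)
  where
    member : (k : Fin (suc j)) → (s + toℕ k) ∈Seg (s , j)
    member k = m≤m+n s (toℕ k) , +-monoʳ-≤ s (s≤s⁻¹ (toℕ<n k))
    offset : (k : Fin (suc j)) → f (s + toℕ k) ∸ h < suc j'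
    offset k = s≤s (subst (_ ≤_) (m+n∸m≡n h j') (∸-monoˡ-≤ h (proj₂ (maps-to (member k)))))
    φ : Fin (suc j) → Fin (suc j')
    φ k = fromℕ< (offset k)
    φ-injective : ∀ {k k'} → φ k ≡ φ k' → k ≡ k'
    φ-injective {k} {k'} φk≡φk' = toℕ-injective (+-cancelˡ-≡ s _ _ (injective (member k) (member k')
      (∸-cancelʳ-≡ (proj₁ (maps-to (member k))) (proj₁ (maps-to (member k')))
        (trans (sym (toℕ-fromℕ< (offset k))) (trans (cong toℕ φk≡φk') (toℕ-fromℕ< (offset k')))))))

module _ {V : Set} where

  InjectiveBelow : ℕ → (ℕ → V) → Set
  InjectiveBelow m g = ∀ {a b} → a < m → b < m → g a ≡ g b → a ≡ b

  Cut : Rel V 0ℓ → (ℕ → V) → ℕ → ℕ → Set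
  Cut _≺_ g m k = 0 < k × k < m × (∀ {a b} → a < k → k ≤ b → b < m → g a ≺ g b)

  -- A direct sum (cut by _<_) or a skew sum (cut by _>_).
  Decomposable : Rel V 0ℓ → (ℕ → V) → ℕ → Set
  Decomposable _≺_ g m = Σ ℕ λ k → Cut _≺_ g m k ⊎ Cut (flip _≺_) g m k

  -- With _>_ in place of _<_ this is an occurrence of 2413.
  Has3142 : Rel V 0ℓ → (ℕ → V) → ℕ → Set
  Has3142 _≺_ g m = Σ ℕ λ a → Σ ℕ λ b → Σ ℕ λ c → Σ ℕ λ d →
    a < b × b < c × c < d × d < m × g b ≺ g d × g d ≺ g a × g a ≺ g c

  injective-prefix : ∀ {g m} → InjectiveBelow (suc m) g → InjectiveBelow m g
  injective-prefix injective a<m b<m = injective (m<n⇒m<1+n a<m) (m<n⇒m<1+n b<m)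

  3142-prefix : ∀ {_≺_ g m} → Has3142 _≺_ g m → Has3142 _≺_ g (suc m)
  3142-prefix (a , b , c , d , a<b , b<c , c<d , d<m , rel) =
    a , b , c , d , a<b , b<c , c<d , m<n⇒m<1+n d<m , rel

  cut-of-pair : ∀ {_≺_ g} → g 0 ≺ g 1 → Cut _≺_ g 2 1
  cut-of-pair {_≺_} {g} g0≺g1 = z<s , ≤-refl , across
    where
      across : ∀ {a b} → a < 1 → 1 ≤ b → b < 2 → g a ≺ g b
      across {zero} {zero} _ () _
      across {zero} {suc zero} _ _ _ = g0≺g1
      across {zero} {suc (suc _)} _ _ (s≤s (s≤s ()))
      across {suc _} (s≤s ()) _ _

-- Let a be least with a < k and g m ≺ g a.  A b between a and k with g b ≺ g m gives the 3142
-- a b k m; otherwise the values before a lie below g m and those from a on above it, so a (or m,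
-- in the opposite direction, if a = 0) cuts g 0 … g m.  If there is no such a, k still cuts.
module CutExtension {V : Set} {_≺_ : Rel V 0ℓ} (≺-trans : Transitive _≺_)
  (≺-connex : ∀ {x y} → x ≢ y → x ≺ y ⊎ y ≺ x) (g : ℕ → V) {m k : ℕ}
  (injective : InjectiveBelow (suc m) g) (cut : Cut _≺_ g m k)
  (no3142 : ¬ Has3142 _≺_ g (suc m)) where

  private
    0<k = proj₁ cut
    k<m = proj₁ (proj₂ cut)
    cross = proj₂ (proj₂ cut)

    distinct-from-last : ∀ {a} → a < m → g a ≢ g m
    distinct-from-last a<m eq = <-irrefl (injective (m<n⇒m<1+n a<m) ≤-refl eq) a<m

    below-last : ∀ {a} → a < m → ¬ g m ≺ g a → g a ≺ g m
    below-last a<m ¬last≺ =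
      [ id , (λ last≺ → ⊥-elim (¬last≺ last≺)) ] (≺-connex (distinct-from-last a<m))

    above-last : ∀ {a} → a < m → ¬ g a ≺ g m → g m ≺ g a
    above-last a<m ¬≺last =
      [ (λ ≺last → ⊥-elim (¬≺last ≺last)) , id ] (≺-connex (distinct-from-last a<m))

    extend : ∀ {c} → (∀ {a b} → a < c → c ≤ b → b < m → g a ≺ g b) →
      (∀ {a} → a < c → g a ≺ g m) → ∀ {a b} → a < c → c ≤ b → b < suc m → g a ≺ g b
    extend old new a<c c≤b b<1+m with m<1+n⇒m<n∨m≡n b<1+m
    ... | inj₁ b<m = old a<c c≤b b<m
    ... | inj₂ refl = new a<c

    cut-around : ∀ a → a < m → (∀ {b} → a ≤ b → b < m → g m ≺ g b) →
      (∀ {b} → b < a → g b ≺ g m) → Decomposable _≺_ g (suc m)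
    cut-around zero 0<m above _ = m , inj₂ (0<m , ≤-refl , λ a<m m≤b b<1+m →
      subst (λ b → g b ≺ g _) (≤-antisym m≤b (s≤s⁻¹ b<1+m)) (above z≤n a<m))
    cut-around (suc a) a<m above below =
      suc a , inj₁ (z<s , m<n⇒m<1+n a<m ,
        extend (λ b<1+a 1+a≤c c<m → ≺-trans (below b<1+a) (above 1+a≤c c<m)) below)

    ExceedsLast : ℕ → Set
    ExceedsLast a = a < k × g m ≺ g a

    BelowLastAfter : ℕ → Set
    BelowLastAfter a = Σ ℕ λ b → a < b × b < k × g b ≺ g m

  extended : ¬ ¬ Decomposable _≺_ g (suc m)
  extended ¬decomposable = ¬¬-excluded-middle {A = Σ ℕ ExceedsLast} λ where
      (no none-exceeds) → ¬decomposable (k , inj₁ (0<k , m<n⇒m<1+n k<m ,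
        extend cross λ a<k → below-last (<-trans a<k k<m) λ last≺ → none-exceeds (_ , a<k , last≺)))
      (yes (_ , exceeds)) → ¬¬-minimal <-wellFounded ExceedsLast exceeds from-least
    where
      from-least : ¬ Σ ℕ λ a → ExceedsLast a × (∀ {b} → b < a → ¬ ExceedsLast b)
      from-least (a , (a<k , last≺a) , least) = ¬¬-excluded-middle {A = BelowLastAfter a} λ where
          (yes (b , a<b , b<k , b≺last)) →
            no3142 (a , b , k , m , a<b , b<k , k<m , ≤-refl , b≺last , last≺a , cross a<k ≤-refl k<m)
          (no none-between) → ¬decomposable (cut-around a (<-trans a<k k<m) (above none-between) below)
        where
          above : ¬ BelowLastAfter a → ∀ {b} → a ≤ b → b < m → g m ≺ g b
          above none-between {b} a≤b b<m with b ℕ.<? k | m≤n⇒m<n∨m≡n a≤b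
          ... | no b≮k | _ = ≺-trans last≺a (cross a<k (≮⇒≥ b≮k) b<m)
          ... | yes _ | inj₂ refl = last≺a
          ... | yes b<k | inj₁ a<b = above-last b<m λ b≺last → none-between (b , a<b , b<k , b≺last)
          below : ∀ {b} → b < a → g b ≺ g m
          below b<a = below-last (<-trans b<a (<-trans a<k k<m)) λ last≺b →
            least b<a (<-trans b<a a<k , last≺b)

≢⇒<⊎> : ∀ {x y} → x ≢ y → x < y ⊎ y < x
≢⇒<⊎> {x} {y} x≢y with <-cmp x y
... | tri< x<y _ _ = inj₁ x<y
... | tri≈ _ x≡y _ = ⊥-elim (x≢y x≡y)
... | tri> _ _ y<x = inj₂ y<x

separable⇒decomposable : ∀ {g : ℕ → ℕ} {m} → 2 ≤ m → InjectiveBelow m g →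
  ¬ Has3142 _<_ g m → ¬ Has3142 _>_ g m → ¬ ¬ Decomposable _<_ g m
separable⇒decomposable {m = zero} ()
separable⇒decomposable {m = suc zero} (s≤s ())
separable⇒decomposable {g} {suc (suc zero)} _ injective _ _ ¬decomposable
  with ≢⇒<⊎> {g 0} {g 1} (λ eq → 0≢1+n (injective z<s (s≤s z<s) eq))
... | inj₁ g0<g1 = ¬decomposable (1 , inj₁ (cut-of-pair {_≺_ = _<_} g0<g1))
... | inj₂ g1<g0 = ¬decomposable (1 , inj₂ (cut-of-pair {_≺_ = flip _<_} g1<g0))
separable⇒decomposable {g} {suc (suc (suc m))} _ injective no3142 no2413 ¬decomposable =
  separable⇒decomposable (s≤s (s≤s z≤n)) (injective-prefix injective)
    (no3142 ∘ 3142-prefix {_≺_ = _<_}) (no2413 ∘ 3142-prefix {_≺_ = _>_}) λ where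
      (_ , inj₁ cut) → CutExtension.extended <-trans ≢⇒<⊎> g injective cut no3142 ¬decomposable
      (_ , inj₂ cut) → CutExtension.extended (flip <-trans) (swap ∘ ≢⇒<⊎>) g injective cut no2413
        λ (k , cut′) → ¬decomposable (k , swap cut′)

StrictlyIncreasing : ∀ {k} → (Fin k → ℕ) → Set
StrictlyIncreasing f = ∀ {a b} → a F.< b → f a < f b

increasing-by-steps : ∀ {k} (f : Fin (suc k) → ℕ) → (∀ i → f (inject₁ i) < f (F.suc i)) →
  StrictlyIncreasing f
increasing-by-steps f step {_} {F.zero} ()
increasing-by-steps {suc k} f step {F.zero} {F.suc F.zero} _ = step F.zero
increasing-by-steps {suc k} f step {F.zero} {F.suc (F.suc j)} _ =
  <-trans (step F.zero) (increasing-by-steps (f ∘ F.suc) (step ∘ F.suc) {F.zero} {F.suc j} z<s)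
increasing-by-steps {suc k} f step {F.suc i} {F.suc j} i<j =
  increasing-by-steps (f ∘ F.suc) (step ∘ F.suc) (ℕ.s<s⁻¹ i<j)

increasing-reflects : ∀ {k} {f : Fin k → ℕ} → StrictlyIncreasing f → ∀ {a b} → f a < f b → a F.< b
increasing-reflects f↗ {a} {b} fa<fb with Finₚ.<-cmp a b
... | tri< a<b _ _ = a<b
... | tri≈ _ refl _ = ⊥-elim (<-irrefl refl fa<fb)
... | tri> _ _ b<a = ⊥-elim (<-asym fa<fb (f↗ b<a))

order-isomorphic-by-sorting : ∀ {k} (u v : Fin k → ℕ) (σ : Fin k → Fin k) →
  (∀ a → ∃ λ i → σ i ≡ a) → StrictlyIncreasing (u ∘ σ) → StrictlyIncreasing (v ∘ σ) →
  ∀ a b → (u a < u b) ⇔ (v a < v b)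
order-isomorphic-by-sorting u v σ onto u↗ v↗ a b with onto a | onto b
... | _ , refl | _ , refl = mk⇔ (v↗ ∘ increasing-reflects u↗) (u↗ ∘ increasing-reflects v↗)

module _ {n : ℕ} where

  -- w as a function on ℕ, with the junk value 0 outside [0, n).
  valℕ : Permutation′ n → ℕ → ℕ
  valℕ w x with x ℕ.<? n
  ... | yes x<n = val w (fromℕ< x<n)
  ... | no _ = 0

  valℕ-fromℕ< : ∀ w {x} (x<n : x < n) → valℕ w x ≡ val w (fromℕ< x<n)
  valℕ-fromℕ< w {x} x<n with x ℕ.<? n
  ... | yes _ = refl
  ... | no x≮n = ⊥-elim (x≮n x<n)

  valℕ-toℕ : ∀ w (t : Fin n) → valℕ w (toℕ t) ≡ val w t
  valℕ-toℕ w t = trans (valℕ-fromℕ< w (toℕ<n t)) (cong (val w) (fromℕ<-toℕ t (toℕ<n t)))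

  valℕ<n : ∀ w {x} → x < n → valℕ w x < n
  valℕ<n w x<n = subst (_< n) (sym (valℕ-fromℕ< w x<n)) (toℕ<n _)

  valℕ-inverse : ∀ w {x} → x < n → valℕ (w ⁻¹) (valℕ w x) ≡ x
  valℕ-inverse w {x} x<n = begin
    valℕ (w ⁻¹) (valℕ w x)                        ≡⟨ cong (valℕ (w ⁻¹)) (valℕ-fromℕ< w x<n) ⟩
    valℕ (w ⁻¹) (toℕ (w ⟨$⟩ʳ fromℕ< x<n))          ≡⟨ valℕ-toℕ (w ⁻¹) _ ⟩
    toℕ (w ⟨$⟩ˡ (w ⟨$⟩ʳ fromℕ< x<n))                 ≡⟨ cong toℕ (inverseˡ w) ⟩
    toℕ (fromℕ< x<n)                                ≡⟨ toℕ-fromℕ< x<n ⟩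
    x                                               ∎
    where open ≡-Reasoning

  valℕ-inverseʳ : ∀ w {x} → x < n → valℕ w (valℕ (w ⁻¹) x) ≡ x
  valℕ-inverseʳ w = valℕ-inverse (w ⁻¹)

  valℕ-injective : ∀ w {x y} → x < n → y < n → valℕ w x ≡ valℕ w y → x ≡ y
  valℕ-injective w {x} {y} x<n y<n eq = begin
    x                            ≡⟨ valℕ-inverse w x<n ⟨
    valℕ (w ⁻¹) (valℕ w x)     ≡⟨ cong (valℕ (w ⁻¹)) eq ⟩
    valℕ (w ⁻¹) (valℕ w y)     ≡⟨ valℕ-inverse w y<n ⟩
    y                            ∎
    where open ≡-Reasoning

  module _ (w : Permutation′ n) where

    -- Unlike IsInterval, this does not tie the lengths of P and V together; block-length shows they agree.
    record Block (P V : Seg) : Set where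
      field
        positions-bounded : end P < n
        values-bounded : end V < n
        forth : ∀ {x} → x ∈Seg P → valℕ w x ∈Seg V
        back : ∀ {x} → x < n → valℕ w x ∈Seg V → x ∈Seg P

    block-length : ∀ {P V} → Block P V → proj₂ P ≡ proj₂ V
    block-length {P} {V} b = ≤-antisym
      (injective-on⇒length≤ (valℕ w) forth λ x∈P y∈P →
        valℕ-injective w (∈-bounded x∈P positions-bounded) (∈-bounded y∈P positions-bounded))
      (injective-on⇒length≤ (valℕ (w ⁻¹)) backward λ x∈V y∈V →
        valℕ-injective (w ⁻¹) (∈-bounded x∈V values-bounded) (∈-bounded y∈V values-bounded))
      where
        open Block b
        backward : ∀ {v} → v ∈Seg V → valℕ (w ⁻¹) v ∈Seg P
        backward v∈V = back (valℕ<n (w ⁻¹) v<n) (subst (_∈Seg V) (sym (valℕ-inverseʳ w v<n)) v∈V)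
          where v<n = ∈-bounded v∈V values-bounded

    block⇒interval : ∀ {P V} → Block P V → IsInterval w V
    block⇒interval {i , _} {h , j} b with block-length b
    ... | refl = values-bounded , i , positions-bounded , forthᶠ , backᶠ
      where
        open Block b
        forthᶠ : (t : Fin n) → toℕ t ∈Seg (i , j) → val w t ∈Seg (h , j)
        forthᶠ t t∈P = subst (_∈Seg _) (valℕ-toℕ w t) (forth t∈P)
        backᶠ : (v : Fin n) → toℕ v ∈Seg (h , j) →
          Σ (Fin n) λ t → toℕ t ∈Seg (i , j) × w ⟨$⟩ʳ t ≡ v
        backᶠ v v∈V = w ⟨$⟩ˡ v , back (toℕ<n _) (subst (_∈Seg _) (sym value) v∈V) , inverseʳ w
          where
            value : valℕ w (toℕ (w ⟨$⟩ˡ v)) ≡ toℕ v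
            value = trans (valℕ-toℕ w _) (cong toℕ (inverseʳ w))

    interval⇒block : ∀ {V} → IsInterval w V → Σ ℕ λ i → Block (i , proj₂ V) V
    interval⇒block {h , j} (end<n , i , i+j<n , forthᶠ , backᶠ) = i , record
      { positions-bounded = i+j<n
      ; values-bounded = end<n
      ; forth = forth
      ; back = back
      }
      where
        forth : ∀ {x} → x ∈Seg (i , j) → valℕ w x ∈Seg (h , j)
        forth x∈P = subst (_∈Seg _) (sym (valℕ-fromℕ< w x<n))
            (forthᶠ _ (subst (_∈Seg _) (sym (toℕ-fromℕ< x<n)) x∈P))
          where x<n = ∈-bounded x∈P i+j<n
        back : ∀ {x} → x < n → valℕ w x ∈Seg (h , j) → x ∈Seg (i , j)
        back {x} x<n x↦V with backᶠ (w ⟨$⟩ʳ fromℕ< x<n) (subst (_∈Seg _) (valℕ-fromℕ< w x<n) x↦V)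
        ... | t , t∈P , wt≡wx = subst (_∈Seg _) position t∈P
          where
            position : toℕ t ≡ x
            position = begin
              toℕ t                            ≡⟨ cong toℕ (inverseˡ w) ⟨
              toℕ (w ⟨$⟩ˡ (w ⟨$⟩ʳ t))           ≡⟨ cong (toℕ ∘ (w ⟨$⟩ˡ_)) wt≡wx ⟩
              toℕ (w ⟨$⟩ˡ (w ⟨$⟩ʳ fromℕ< x<n))  ≡⟨ cong toℕ (inverseˡ w) ⟩
              toℕ (fromℕ< x<n)                 ≡⟨ toℕ-fromℕ< x<n ⟩
              x                                ∎
              where open ≡-Reasoning

    point-block : ∀ {x} → x < n → Block (x , 0) (valℕ w x , 0)
    point-block {x} x<n = record
      { positions-bounded = subst (_< n) (sym (+-identityʳ x)) x<n
      ; values-bounded = subst (_< n) (sym (+-identityʳ _)) (valℕ<n w x<n)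
      ; forth = λ y∈ → subst (λ y → valℕ w y ∈Seg _) (sym (∈-point y∈)) start∈
      ; back = λ y<n wy∈ → subst (_∈Seg _) (sym (valℕ-injective w y<n x<n (∈-point wy∈))) start∈
      }

    whole-block : 0 < n → Block (0 , pred n) (0 , pred n)
    whole-block 0<n = record
      { positions-bounded = pred<n
      ; values-bounded = pred<n
      ; forth = λ x∈ → z≤n , <⇒≤pred (valℕ<n w (∈-bounded x∈ pred<n))
      ; back = λ x<n _ → z≤n , <⇒≤pred x<n
      }
      where
        pred<n : pred n < n
        pred<n = ≤-reflexive (suc-pred n {{ℕ.>-nonZero 0<n}})

    hull-block : ∀ {P₁ V₁ P₂ V₂ v} → Block P₁ V₁ → Block P₂ V₂ → v ∈Seg V₁ → v ∈Seg V₂ →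
      Block (hull P₁ P₂) (hull V₁ V₂)
    hull-block {P₁} {V₁} {P₂} {V₂} {v} b₁ b₂ v∈V₁ v∈V₂ = record
      { positions-bounded =
          subst (_< n) (sym (end-hull {P₁} {P₂})) (⊔-pres-<m B₁.positions-bounded B₂.positions-bounded)
      ; values-bounded = subst (_< n) (sym (end-hull {V₁} {V₂})) (⊔-pres-<m B₁.values-bounded B₂.values-bounded)
      ; forth = λ x∈P →
          [ ⊆-hullˡ {V₁} {V₂} _ ∘ B₁.forth , ⊆-hullʳ {V₂} {V₁} _ ∘ B₂.forth ]′ (hull-split r∈P₁ r∈P₂ x∈P)
      ; back = λ x<n wx∈V →
          [ ⊆-hullˡ {P₁} {P₂} _ ∘ B₁.back x<n , ⊆-hullʳ {P₂} {P₁} _ ∘ B₂.back x<n ]′ (hull-split v∈V₁ v∈V₂ wx∈V)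
      }
      where
        module B₁ = Block b₁
        module B₂ = Block b₂
        v<n = ∈-bounded v∈V₁ B₁.values-bounded
        r = valℕ (w ⁻¹) v
        r<n = valℕ<n (w ⁻¹) v<n
        wr≡v = valℕ-inverseʳ w v<n
        r∈P₁ = B₁.back r<n (subst (_∈Seg V₁) (sym wr≡v) v∈V₁)
        r∈P₂ = B₂.back r<n (subst (_∈Seg V₂) (sym wr≡v) v∈V₂)

    block-convex : ∀ {P V x y z} → Block P V → x < y → y < z → z < n →
      valℕ w x ∈Seg V → valℕ w z ∈Seg V → valℕ w y ∈Seg V
    block-convex b x<y y<z z<n wx∈V wz∈V =
      forth (∈-convex (back x<n wx∈V) (back z<n wz∈V) (<⇒≤ x<y) (<⇒≤ y<z))
      where
        open Block b
        x<n = <-trans x<y (<-trans y<z z<n)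

    record Decomposition (A : Seg) : Set where
      field
        left right : Seg
        left-interval : IsInterval w left
        right-interval : IsInterval w right
        left-start : start left ≡ start A
        adjacent : suc (end left) ≡ start right
        right-end : end right ≡ end A

    block-decomposition : ∀ {P h j L R} → Block P (h , j) → L ⊆Seg P → R ⊆Seg P →
      (∀ {x} → x ∈Seg P → x ∈Seg L ⊎ x ∈Seg R) →
      (∀ {x y} → x ∈Seg L → y ∈Seg R → valℕ w x < valℕ w y) → Decomposition (h , j)
    block-decomposition {P} {h} {j} {L} {R} b L⊆P R⊆P L∪R L<R = record
      { left = span h c
      ; right = span (suc c) (h + j)
      ; left-interval = block⇒interval left-block
      ; right-interval = block⇒interval right-block
      ; left-start = refl
      ; adjacent = cong suc (end-span h≤c)
      ; right-end = end-span c<end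
      }
      where
        open Block b
        l = proj₁ (argmax (valℕ w) L)
        l∈L = proj₁ (proj₂ (argmax (valℕ w) L))
        l-max = proj₂ (proj₂ (argmax (valℕ w) L))
        c = valℕ w l
        h≤c : h ≤ c
        h≤c = proj₁ (forth (L⊆P _ l∈L))
        c<end : c < h + j
        c<end = <-≤-trans (L<R l∈L start∈) (proj₂ (forth (R⊆P _ start∈)))
        left-block : Block L (span h c)
        left-block = record
          { positions-bounded = ≤-<-trans (⊆-end L⊆P) positions-bounded
          ; values-bounded = subst (_< n) (sym (end-span h≤c)) (<-trans c<end values-bounded)
          ; forth = λ x∈L → ∈-span⁺ (proj₁ (forth (L⊆P _ x∈L))) (l-max x∈L)
          ; back = left-back
          }
          where
            left-back : ∀ {x} → x < n → valℕ w x ∈Seg span h c → x ∈Seg L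
            left-back x<n wx∈ with ∈-span⁻ h≤c wx∈
            ... | h≤wx , wx≤c = [ id , (λ x∈R → ⊥-elim (<⇒≱ (L<R l∈L x∈R) wx≤c)) ]
                                  (L∪R (back x<n (h≤wx , ≤-trans wx≤c (<⇒≤ c<end))))
        right-block : Block R (span (suc c) (h + j))
        right-block = record
          { positions-bounded = ≤-<-trans (⊆-end R⊆P) positions-bounded
          ; values-bounded = subst (_< n) (sym (end-span c<end)) values-bounded
          ; forth = λ y∈R → ∈-span⁺ (L<R l∈L y∈R) (proj₂ (forth (R⊆P _ y∈R)))
          ; back = right-back
          }
          where
            right-back : ∀ {x} → x < n → valℕ w x ∈Seg span (suc c) (h + j) → x ∈Seg R
            right-back x<n wx∈ with ∈-span⁻ c<end wx∈
            ... | c<wx , wx≤end = [ (λ x∈L → ⊥-elim (<⇒≱ c<wx (l-max x∈L))) , id ]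
                                    (L∪R (back x<n (≤-trans h≤c (<⇒≤ c<wx) , wx≤end)))

    interval-hull : ∀ {V₁ V₂ v} → IsInterval w V₁ → IsInterval w V₂ → v ∈Seg V₁ → v ∈Seg V₂ →
      IsInterval w (hull V₁ V₂)
    interval-hull i₁ i₂ v∈V₁ v∈V₂ =
      block⇒interval (hull-block (proj₂ (interval⇒block i₁)) (proj₂ (interval⇒block i₂)) v∈V₁ v∈V₂)

    covered-interval : ∀ {A M} → Covers w A M → IsInterval w M
    covered-interval (_ , iM , _) = iM

    covered⊆ : ∀ {A M} → Covers w A M → M ⊆Seg A
    covered⊆ (_ , _ , (M⊆A , _) , _) = M⊆A

    covers-gap : ∀ {A M C x y} → Covers w A M → IsInterval w C → M ⊆Seg C → C ⊆Seg A →
      x ∈Seg C → ¬ x ∈Seg M → y ∈Seg A → ¬ y ∈Seg C → ⊥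
    covers-gap (_ , _ , _ , nothing-between) iC M⊆C C⊆A x∈C x∉M y∈A y∉C =
      nothing-between (_ , iC , (M⊆C , λ C⊆M → x∉M (C⊆M _ x∈C)) , (C⊆A , λ A⊆C → y∉C (A⊆C _ y∈A)))

    covered-⊆⇒≡ : ∀ {A M M′} → Covers w A M → Covers w A M′ → M ⊆Seg M′ → M ≡ M′
    covered-⊆⇒≡ {M = M} {M′} (_ , _ , _ , nothing-between) (_ , iM′ , M′⊂A , _) M⊆M′ =
      decidable-stable (≡-dec _≟_ _≟_ M M′) λ M≢M′ →
        nothing-between (M′ , iM′ , (M⊆M′ , λ M′⊆M → M≢M′ (⊆-antisym M⊆M′ M′⊆M)) , M′⊂A)

    covered-comparable⇒≡ : ∀ {A M M′} → Covers w A M → Covers w A M′ → M ⊆Seg M′ ⊎ M′ ⊆Seg M → M ≡ M′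
    covered-comparable⇒≡ cov cov′ (inj₁ M⊆M′) = covered-⊆⇒≡ cov cov′ M⊆M′
    covered-comparable⇒≡ cov cov′ (inj₂ M′⊆M) = sym (covered-⊆⇒≡ cov′ cov M′⊆M)

    covered-at-start⇒≡ : ∀ {A M M′} → Covers w A M → Covers w A M′ →
      start A ∈Seg M → start A ∈Seg M′ → M ≡ M′
    covered-at-start⇒≡ {A} {M} {M′} cov cov′ s∈M s∈M′ = covered-comparable⇒≡ cov cov′
      (same-start⇒comparable {M} {M′}
        (trans (start-shared s∈M (covered⊆ cov)) (sym (start-shared s∈M′ (covered⊆ cov′)))))

    covered-at-end⇒≡ : ∀ {A M M′} → Covers w A M → Covers w A M′ →
      end A ∈Seg M → end A ∈Seg M′ → M ≡ M′
    covered-at-end⇒≡ {A} {M} {M′} cov cov′ e∈M e∈M′ = covered-comparable⇒≡ cov cov′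
      (same-end⇒comparable {M} {M′}
        (trans (end-shared e∈M (covered⊆ cov)) (sym (end-shared e∈M′ (covered⊆ cov′)))))

    -- M lies in the left part, in the right part, or straddles the cut and then forms an interval with
    -- the left part; each case yields an interval strictly between M and A.
    covered-meets-end : ∀ {h j M} → Decomposition (h , j) → Covers w (h , j) M →
      ¬ h ∈Seg M → ¬ (h + j) ∈Seg M → ⊥
    covered-meets-end {h} {j} {M@(a , b)} d cov h∉M e∉M = by-position ((a + b) ≤? end L) (start R ≤? a)
      where
        open Decomposition d renaming (left to L; right to R)
        L<R : end L < start R
        L<R = ≤-reflexive adjacent
        L⊆A : L ⊆Seg (h , j)
        L⊆A = ⊆-intro (≤-reflexive (sym left-start))
          (<⇒≤ (<-≤-trans L<R (subst (start R ≤_) right-end (start≤end {R}))))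
        R⊆A : R ⊆Seg (h , j)
        R⊆A = ⊆-intro (<⇒≤ (≤-<-trans (subst (_≤ end L) left-start (start≤end {L})) L<R)) (≤-reflexive right-end)
        h∈L : h ∈Seg L
        h∈L = subst (_∈Seg L) left-start (start∈ {L})
        e∈R : (h + j) ∈Seg R
        e∈R = subst (_∈Seg R) right-end (end∈ {R})
        e∉L : ¬ (h + j) ∈Seg L
        e∉L (_ , e≤L) = <⇒≱ (<-≤-trans L<R (proj₁ e∈R)) e≤L
        h∉R : ¬ h ∈Seg R
        h∉R (R≤h , _) = <⇒≱ (<-≤-trans L<R R≤h) (proj₂ h∈L)
        M⊆A = covered⊆ cov
        by-position : Dec (a + b ≤ end L) → Dec (start R ≤ a) → ⊥
        by-position (yes M≤L) _ =
          covers-gap cov left-interval (⊆-intro (≤-trans (≤-reflexive left-start) (⊆-start M⊆A)) M≤L) L⊆A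
            h∈L h∉M end∈ e∉L
        by-position (no _) (yes R≤M) =
          covers-gap cov right-interval (⊆-intro R≤M (≤-trans (⊆-end M⊆A) (≤-reflexive (sym right-end)))) R⊆A
            e∈R e∉M start∈ h∉R
        by-position (no M≰L) (no R≰M) =
          covers-gap cov (interval-hull left-interval (covered-interval cov) c∈L c∈M) (⊆-hullʳ {M} {L})
            (hull-least {L} L⊆A M⊆A) (⊆-hullˡ {L} {M} _ h∈L) h∉M
            end∈ ([ e∉L , e∉M ] ∘ hull-split c∈L c∈M)
          where
            c∈L : end L ∈Seg L
            c∈L = end∈ {L}
            c∈M : end L ∈Seg M
            c∈M = s≤s⁻¹ (subst (a <_) (sym adjacent) (≰⇒> R≰M)) , <⇒≤ (≰⇒> M≰L)

    covered-contains-end : ∀ {h j M} → Decomposition (h , j) → Covers w (h , j) M →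
      h ∈Seg M ⊎ (h + j) ∈Seg M
    covered-contains-end {h} {j} {M} d cov with h ∈? M | (h + j) ∈? M
    ... | yes h∈M | _ = inj₁ h∈M
    ... | no _ | yes e∈M = inj₂ e∈M
    ... | no h∉M | no e∉M = ⊥-elim (covered-meets-end d cov h∉M e∉M)

    decomposable-covers-at-most-two : ∀ {h j M₁ M₂ M₃} → Decomposition (h , j) →
      Covers w (h , j) M₁ → Covers w (h , j) M₂ → Covers w (h , j) M₃ →
      M₁ ≢ M₂ → M₁ ≢ M₃ → M₂ ≢ M₃ → ⊥
    decomposable-covers-at-most-two d c₁ c₂ c₃ M₁≢M₂ M₁≢M₃ M₂≢M₃
      with covered-contains-end d c₁ | covered-contains-end d c₂ | covered-contains-end d c₃
    ... | inj₁ s₁ | inj₁ s₂ | _       = M₁≢M₂ (covered-at-start⇒≡ c₁ c₂ s₁ s₂)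
    ... | inj₁ s₁ | inj₂ _  | inj₁ s₃ = M₁≢M₃ (covered-at-start⇒≡ c₁ c₃ s₁ s₃)
    ... | inj₁ _  | inj₂ e₂ | inj₂ e₃ = M₂≢M₃ (covered-at-end⇒≡ c₂ c₃ e₂ e₃)
    ... | inj₂ _  | inj₁ s₂ | inj₁ s₃ = M₂≢M₃ (covered-at-start⇒≡ c₂ c₃ s₂ s₃)
    ... | inj₂ e₁ | inj₁ _  | inj₂ e₃ = M₁≢M₃ (covered-at-end⇒≡ c₁ c₃ e₁ e₃)
    ... | inj₂ e₁ | inj₂ e₂ | _       = M₁≢M₂ (covered-at-end⇒≡ c₁ c₂ e₁ e₂)

    ¬¬-covered-above : ∀ {A B} → IsInterval w A → IsInterval w B → B ⊂Seg A →
      ¬ ¬ (Σ Seg λ M → Covers w A M × B ⊆Seg M)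
    ¬¬-covered-above {A} {B} iA iB B⊂A none =
      ¬¬-minimal (⊃-within-wellFounded A) Candidate (iB , (λ _ x∈B → x∈B) , B⊂A)
        λ (M , (iM , B⊆M , M⊂A) , maximal) →
          none (M , (iA , iM , M⊂A , λ (C , iC , M⊂C , C⊂A) →
            maximal (M⊂C , C⊂A) (iC , (λ x x∈B → proj₁ M⊂C x (B⊆M x x∈B)) , C⊂A)) , B⊆M)
      where
        Candidate : Seg → Set
        Candidate C = IsInterval w C × B ⊆Seg C × C ⊂Seg A

    contains-by-sorting : ∀ {k} (π : Vec ℕ (suc k)) (σ : Fin (suc k) → Fin (suc k)) (p : Fin (suc k) → ℕ) →
      (∀ a → ∃ λ i → σ i ≡ a) → (∀ i → lookup π (σ (inject₁ i)) < lookup π (σ (F.suc i))) →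
      (∀ a → p a < n) → (∀ i → p (inject₁ i) < p (F.suc i)) →
      (∀ i → valℕ w (p (σ (inject₁ i))) < valℕ w (p (σ (F.suc i)))) → Contains w π
    contains-by-sorting {k} π σ p onto π-sorted p<n p-steps values-sorted =
      position , position↗ , λ a b →
        subst₂ (λ x y → (x < y) ⇔ _) (valℕ-fromℕ< w (p<n a)) (valℕ-fromℕ< w (p<n b))
        (order-isomorphic-by-sorting (valℕ w ∘ p) (lookup π) σ onto
          (increasing-by-steps _ values-sorted) (increasing-by-steps _ π-sorted) a b)
      where
        position : Fin (suc k) → Fin n
        position a = fromℕ< (p<n a)
        position↗ : ∀ a b → a F.< b → position a F.< position b
        position↗ a b a<b = subst₂ _<_ (sym (toℕ-fromℕ< (p<n a))) (sym (toℕ-fromℕ< (p<n b)))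
          (increasing-by-steps p p-steps a<b)

    window : ℕ → ℕ → ℕ
    window i a = valℕ w (i + a)

    window-offset : ∀ {i J x} → x ∈Seg (i , J) → window i (x ∸ i) ≡ valℕ w x
    window-offset (i≤x , _) = cong (valℕ w) (m+[n∸m]≡n i≤x)

    cut-positions : ∀ {_≺_ i J k} → Cut _≺_ (window i) (suc J) (suc k) →
      ∀ {x y} → x ∈Seg (i , k) → y ∈Seg span (i + suc k) (i + J) → valℕ w x ≺ valℕ w y
    cut-positions {_≺_} {i} {J} {k} (_ , k<1+J , cross) {x} {y} x∈L@(_ , x≤) y∈R =
      subst₂ _≺_ (window-offset x∈L) (window-offset {i} {J} (i≤y , y≤))
        (cross offset-x<k k≤offset-y offset-y<1+J)
      where
        i+k≤y = proj₁ (∈-span⁻ (+-monoʳ-≤ i (s≤s⁻¹ k<1+J)) y∈R)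
        y≤ = proj₂ (∈-span⁻ (+-monoʳ-≤ i (s≤s⁻¹ k<1+J)) y∈R)
        i≤y = ≤-trans (m≤m+n i (suc k)) i+k≤y
        offset-x<k : x ∸ i < suc k
        offset-x<k = s≤s (subst (x ∸ i ≤_) (m+n∸m≡n i k) (∸-monoˡ-≤ i x≤))
        k≤offset-y : suc k ≤ y ∸ i
        k≤offset-y = subst (_≤ y ∸ i) (m+n∸m≡n i (suc k)) (∸-monoˡ-≤ i i+k≤y)
        offset-y<1+J : y ∸ i < suc J
        offset-y<1+J = s≤s (subst (y ∸ i ≤_) (m+n∸m≡n i J) (∸-monoˡ-≤ i y≤))

    contains-by-sorting₄ : (π : Vec ℕ 4) (σ : Fin 4 → Fin 4) → (∀ a → ∃ λ i → σ i ≡ a) →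
      (∀ i → lookup π (σ (inject₁ i)) < lookup π (σ (F.suc i))) →
      ∀ {p₀ p₁ p₂ p₃} → p₀ < p₁ → p₁ < p₂ → p₂ < p₃ → p₃ < n →
      (∀ i → let p = lookup (p₀ ∷ p₁ ∷ p₂ ∷ p₃ ∷ []) in
             valℕ w (p (σ (inject₁ i))) < valℕ w (p (σ (F.suc i)))) →
      Contains w π
    contains-by-sorting₄ π σ onto π-sorted {p₀} {p₁} {p₂} {p₃} p₀<p₁ p₁<p₂ p₂<p₃ p₃<n =
      contains-by-sorting π σ (lookup (p₀ ∷ p₁ ∷ p₂ ∷ p₃ ∷ [])) onto π-sorted
        (λ { F.zero → <-trans p₀<p₁ p₁<n ; (F.suc F.zero) → p₁<n
           ; (F.suc (F.suc F.zero)) → p₂<n ; (F.suc (F.suc (F.suc F.zero))) → p₃<n })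
        (λ { F.zero → p₀<p₁ ; (F.suc F.zero) → p₁<p₂ ; (F.suc (F.suc F.zero)) → p₂<p₃ })
      where
        p₂<n = <-trans p₂<p₃ p₃<n
        p₁<n = <-trans p₁<p₂ p₂<n

    contains-3142 : ∀ {p₀ p₁ p₂ p₃} → p₀ < p₁ → p₁ < p₂ → p₂ < p₃ → p₃ < n →
      valℕ w p₁ < valℕ w p₃ → valℕ w p₃ < valℕ w p₀ → valℕ w p₀ < valℕ w p₂ → Contains w p3142
    contains-3142 p₀<p₁ p₁<p₂ p₂<p₃ p₃<n v₁<v₃ v₃<v₀ v₀<v₂ =
      contains-by-sorting₄ p3142 (lookup (# 1 ∷ # 3 ∷ # 0 ∷ # 2 ∷ []))
        (λ { F.zero → # 2 , refl ; (F.suc F.zero) → # 0 , refl ; (F.suc (F.suc F.zero)) → # 3 , refl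
           ; (F.suc (F.suc (F.suc F.zero))) → # 1 , refl })
        (λ { F.zero → ≤-refl ; (F.suc F.zero) → ≤-refl ; (F.suc (F.suc F.zero)) → ≤-refl })
        p₀<p₁ p₁<p₂ p₂<p₃ p₃<n
        (λ { F.zero → v₁<v₃ ; (F.suc F.zero) → v₃<v₀ ; (F.suc (F.suc F.zero)) → v₀<v₂ })

    contains-2413 : ∀ {p₀ p₁ p₂ p₃} → p₀ < p₁ → p₁ < p₂ → p₂ < p₃ → p₃ < n →
      valℕ w p₂ < valℕ w p₀ → valℕ w p₀ < valℕ w p₃ → valℕ w p₃ < valℕ w p₁ → Contains w p2413
    contains-2413 p₀<p₁ p₁<p₂ p₂<p₃ p₃<n v₂<v₀ v₀<v₃ v₃<v₁ =
      contains-by-sorting₄ p2413 (lookup (# 2 ∷ # 0 ∷ # 3 ∷ # 1 ∷ []))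
        (λ { F.zero → # 1 , refl ; (F.suc F.zero) → # 3 , refl ; (F.suc (F.suc F.zero)) → # 0 , refl
           ; (F.suc (F.suc (F.suc F.zero))) → # 2 , refl })
        (λ { F.zero → ≤-refl ; (F.suc F.zero) → ≤-refl ; (F.suc (F.suc F.zero)) → ≤-refl })
        p₀<p₁ p₁<p₂ p₂<p₃ p₃<n
        (λ { F.zero → v₂<v₀ ; (F.suc F.zero) → v₀<v₃ ; (F.suc (F.suc F.zero)) → v₃<v₁ })

    decomposable⇒decomposition : ∀ {i h J} → Block (i , J) (h , J) → Decomposable _<_ (window i) (suc J) →
      Decomposition (h , J)
    decomposable⇒decomposition b (zero , inj₁ (() , _))
    decomposable⇒decomposition b (zero , inj₂ (() , _))
    decomposable⇒decomposition {i} {h} {J} b (suc k , cut) =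
      [ (λ c → block-decomposition b L⊆P R⊆P cover (cut-positions {_<_} c))
      , (λ c → block-decomposition b R⊆P L⊆P (swap ∘ cover) (flip (cut-positions {flip _<_} c))) ]′ cut
      where
        k≤J : suc k ≤ J
        k≤J = s≤s⁻¹ ([ proj₁ ∘ proj₂ , proj₁ ∘ proj₂ ] cut)
        i+k≤i+J = +-monoʳ-≤ i k≤J
        L⊆P : (i , k) ⊆Seg (i , J)
        L⊆P = ⊆-intro ≤-refl (+-monoʳ-≤ i (≤-trans (n≤1+n k) k≤J))
        R⊆P : span (i + suc k) (i + J) ⊆Seg (i , J)
        R⊆P = ⊆-intro (m≤m+n i (suc k)) (≤-reflexive (end-span i+k≤i+J))
        cover : ∀ {x} → x ∈Seg (i , J) → x ∈Seg (i , k) ⊎ x ∈Seg span (i + suc k) (i + J)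
        cover {x} (i≤x , x≤) with x ≤? i + k
        ... | yes x≤i+k = inj₁ (i≤x , x≤i+k)
        ... | no x≰i+k = inj₂ (∈-span⁺ (subst (_≤ x) (sym (+-suc i k)) (≰⇒> x≰i+k)) x≤)

    ¬¬-decomposition : ∀ {h j} → IsInterval w (h , suc j) → Avoids w p2413 → Avoids w p3142 →
      ¬ ¬ Decomposition (h , suc j)
    ¬¬-decomposition {h} {j} iA avoids-2413 avoids-3142 no-decomposition =
      separable⇒decomposable (s≤s (s≤s z≤n)) injective no-3142 no-2413
        (no-decomposition ∘ decomposable⇒decomposition b)
      where
        i = proj₁ (interval⇒block iA)
        b = proj₂ (interval⇒block iA)
        in-window : ∀ {a} → a < suc (suc j) → i + a < n
        in-window a<2+j = ≤-<-trans (+-monoʳ-≤ i (s≤s⁻¹ a<2+j)) (Block.positions-bounded b)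
        injective : InjectiveBelow (suc (suc j)) (window i)
        injective a<2+j b<2+j eq =
          +-cancelˡ-≡ i _ _ (valℕ-injective w (in-window a<2+j) (in-window b<2+j) eq)
        no-3142 : ¬ Has3142 _<_ (window i) (suc (suc j))
        no-3142 (_ , _ , _ , _ , a<b , b<c , c<d , d<m , b≺d , d≺a , a≺c) =
          avoids-3142 (contains-3142 (+-monoʳ-< i a<b) (+-monoʳ-< i b<c) (+-monoʳ-< i c<d) (in-window d<m)
            b≺d d≺a a≺c)
        no-2413 : ¬ Has3142 _>_ (window i) (suc (suc j))
        no-2413 (_ , _ , _ , _ , a<b , b<c , c<d , d<m , b≻d , d≻a , a≻c) =
          avoids-2413 (contains-2413 (+-monoʳ-< i a<b) (+-monoʳ-< i b<c) (+-monoʳ-< i c<d) (in-window d<m)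
            a≻c d≻a b≻d)

    avoiding⇒¬covers-three : Avoids w p2413 → Avoids w p3142 → ¬ SomeCoversThree w
    avoiding⇒¬covers-three _ _ ((_ , zero) , _ , _ , _ , (_ , _ , M⊂A , _) , _) = n≮0 (⊂⇒length< M⊂A)
    avoiding⇒¬covers-three avoids-2413 avoids-3142 ((_ , suc _) , _ , _ , _ , c₁ , c₂ , c₃ , ≢₁₂ , ≢₁₃ , ≢₂₃) =
      ¬¬-decomposition (proj₁ c₁) avoids-2413 avoids-3142 λ d →
        decomposable-covers-at-most-two d c₁ c₂ c₃ ≢₁₂ ≢₁₃ ≢₂₃

    -- The betweenness conditions hold for the positions p₀ < p₁ < p₂ < p₃ of a 2413 as well as of a 3142.
    module Crossing {p₀ p₁ p₂ p₃ : ℕ} (p₀<p₁ : p₀ < p₁) (p₁<p₂ : p₁ < p₂) (p₂<p₃ : p₂ < p₃)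
      (p₃<n : p₃ < n) (v₃-between : Between (valℕ w p₀) (valℕ w p₃) (valℕ w p₁))
      (v₀-between : Between (valℕ w p₁) (valℕ w p₀) (valℕ w p₂)) where

      private
        p₂<n = <-trans p₂<p₃ p₃<n
        p₁<n = <-trans p₁<p₂ p₂<n
        p₀<n = <-trans p₀<p₁ p₁<n
        p₀<p₂ = <-trans p₀<p₁ p₁<p₂

        Full : Seg → Set
        Full C = valℕ w p₀ ∈Seg C × valℕ w p₁ ∈Seg C × valℕ w p₂ ∈Seg C × valℕ w p₃ ∈Seg C

        full-from-03 : ∀ {C} → IsInterval w C → valℕ w p₀ ∈Seg C → valℕ w p₃ ∈Seg C → Full C
        full-from-03 iC v₀∈C v₃∈C =
          v₀∈C , inside p₀<p₁ (<-trans p₁<p₂ p₂<p₃) , inside p₀<p₂ p₂<p₃ , v₃∈C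
          where
            inside : ∀ {y} → p₀ < y → y < p₃ → valℕ w y ∈Seg _
            inside p₀<y y<p₃ = block-convex (proj₂ (interval⇒block iC)) p₀<y y<p₃ p₃<n v₀∈C v₃∈C

        full-from-01 : ∀ {C} → IsInterval w C → valℕ w p₀ ∈Seg C → valℕ w p₁ ∈Seg C → Full C
        full-from-01 iC v₀∈C v₁∈C = full-from-03 iC v₀∈C (∈-between v₀∈C v₁∈C v₃-between)

        full-from-02 : ∀ {C} → IsInterval w C → valℕ w p₀ ∈Seg C → valℕ w p₂ ∈Seg C → Full C
        full-from-02 iC v₀∈C v₂∈C =
          full-from-01 iC v₀∈C (block-convex (proj₂ (interval⇒block iC)) p₀<p₁ p₁<p₂ p₂<n v₀∈C v₂∈C)

        full-from-12 : ∀ {C} → IsInterval w C → valℕ w p₁ ∈Seg C → valℕ w p₂ ∈Seg C → Full C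
        full-from-12 iC v₁∈C v₂∈C = full-from-01 iC (∈-between v₁∈C v₂∈C v₀-between) v₁∈C

        whole : IsInterval w (0 , pred n)
        whole = block⇒interval (whole-block (≤-<-trans z≤n p₀<n))

        in-whole : ∀ {x} → x < n → valℕ w x ∈Seg (0 , pred n)
        in-whole x<n = z≤n , <⇒≤pred (valℕ<n w x<n)

        covered-above-value : ∀ {A x y} → IsInterval w A → x < n → y < n → x ≢ y →
          valℕ w x ∈Seg A → valℕ w y ∈Seg A → ¬ ¬ (Σ Seg λ M → Covers w A M × valℕ w x ∈Seg M)
        covered-above-value iA x<n y<n x≢y x∈A y∈A none =
          ¬¬-covered-above iA (block⇒interval (point-block x<n))
            (point⊂ x∈A y∈A λ wy≡wx → x≢y (valℕ-injective w x<n y<n (sym wy≡wx)))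
            λ (M , cov , x⊆M) → none (M , cov , x⊆M _ start∈)

        covered-points : (A : Seg) → IsInterval w A → Full A →
          (∀ {C} → C ⊂Seg A → ¬ (IsInterval w C × Full C)) → ¬ ¬ SomeCoversThree w
        covered-points A iA (v₀∈A , v₁∈A , v₂∈A , _) minimal no-three =
          covered-above-value iA p₀<n p₁<n (<⇒≢ p₀<p₁) v₀∈A v₁∈A λ (M₀ , c₀ , v₀∈M₀) →
          covered-above-value iA p₁<n p₀<n (≢-sym (<⇒≢ p₀<p₁)) v₁∈A v₀∈A λ (M₁ , c₁ , v₁∈M₁) →
          covered-above-value iA p₂<n p₀<n (≢-sym (<⇒≢ p₀<p₂)) v₂∈A v₀∈A λ (M₂ , c₂ , v₂∈M₂) →
          no-three (A , M₀ , M₁ , M₂ , c₀ , c₁ , c₂ ,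
            (λ { refl → not-full c₀ (full-from-01 (covered-interval c₀) v₀∈M₀ v₁∈M₁) }) ,
            (λ { refl → not-full c₀ (full-from-02 (covered-interval c₀) v₀∈M₀ v₂∈M₂) }) ,
            (λ { refl → not-full c₁ (full-from-12 (covered-interval c₁) v₁∈M₁ v₂∈M₂) }))
          where
            not-full : ∀ {M} → Covers w A M → ¬ Full M
            not-full (_ , iM , M⊂A , _) full = minimal M⊂A (iM , full)

      some-covers-three : ¬ ¬ SomeCoversThree w
      some-covers-three no-three =
        ¬¬-minimal ⊂-wellFounded (λ C → IsInterval w C × Full C)
          (whole , in-whole p₀<n , in-whole p₁<n , in-whole p₂<n , in-whole p₃<n)
          λ (A , (iA , full) , minimal) → covered-points A iA full minimal no-three

    contained-order : ∀ {k} {π : Vec ℕ k} (occurrence : Contains w π) (a b : Fin k) →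
      {T (lookup π a ℕ.<ᵇ lookup π b)} →
      valℕ w (toℕ (proj₁ occurrence a)) < valℕ w (toℕ (proj₁ occurrence b))
    contained-order (f , _ , same-order) a b {π<} =
      subst₂ _<_ (sym (valℕ-toℕ w (f a))) (sym (valℕ-toℕ w (f b)))
        (Equivalence.from (same-order a b) (<ᵇ⇒< _ _ π<))

    ¬covers-three⇒avoids-2413 : ¬ SomeCoversThree w → Avoids w p2413
    ¬covers-three⇒avoids-2413 no-three occurrence@(f , f↗ , _) =
      Crossing.some-covers-three (f↗ (# 0) (# 1) z<s) (f↗ (# 1) (# 2) (s<s z<s)) (f↗ (# 2) (# 3) (s<s (s<s z<s)))
        (toℕ<n (f (# 3)))
        (inj₁ (order (# 0) (# 3) , order (# 3) (# 1)))
        (inj₂ (order (# 2) (# 0) , order (# 0) (# 1)))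
        no-three
      where order = contained-order {π = p2413} occurrence

    ¬covers-three⇒avoids-3142 : ¬ SomeCoversThree w → Avoids w p3142
    ¬covers-three⇒avoids-3142 no-three occurrence@(f , f↗ , _) =
      Crossing.some-covers-three (f↗ (# 0) (# 1) z<s) (f↗ (# 1) (# 2) (s<s z<s)) (f↗ (# 2) (# 3) (s<s (s<s z<s)))
        (toℕ<n (f (# 3)))
        (inj₂ (order (# 1) (# 3) , order (# 3) (# 0)))
        (inj₁ (order (# 1) (# 0) , order (# 0) (# 2)))
        no-three
      where order = contained-order {π = p3142} occurrence

theorem6p2 : (n : ℕ) (w : Permutation′ n) →
    (¬ SomeCoversThree w) ⇔ (Avoids w p2413 × Avoids w p3142)
theorem6p2 n w = mk⇔
  (λ no-three → ¬covers-three⇒avoids-2413 w no-three , ¬covers-three⇒avoids-3142 w no-three)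
  (λ (avoids-2413 , avoids-3142) → avoiding⇒¬covers-three w avoids-2413 avoids-3142)
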